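{- Let $s \geq 1$ and $t \geq 2$ be integers and let $\alpha_{s,t}$ be the type-$\alpha$ comb with $s$ teeth of length $t$. Then the number of linear extensions of $\alpha_{s,t}$ that avoid both patterns $213$ and $312$ equals $2^{s-1}$.
   Context: A linear extension of a finite poset $P$ on a set of integers is a listing $v=[v_1,\dots,v_n]$ of all elements of $P$, each exactly once, such that whenever $a \leq_P b$, $a$ appears before $b$. For $w \in S_3$, a sequence $v$ of distinct integers contains $w$ if there are indices $i<j<k$ with $(v_i,v_j,v_k)$ in the same relative order as $(w_1,w_2,w_3)$; otherwise $v$ avoids $w$. The type-$\alpha$ comb $\alpha_{s,t}$ is the poset on $\{1,\dots,st\}$ whose order is generated by the relations $i \leq i+1$ for $1 \leq i \leq s-1$ (the spine $1,\dots,s$) and $x \leq x+s$ for $1 \leq x \leq (t-1)s$ (so the teeth are $c, c+s, \dots, c+(t-1)s$ for $1\le c\le s$). -}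

module Defs where

open import Data.Nat using (ℕ; zero; suc; _+_; _*_; _∸_; _≤_; _<_)
open import Data.List using (List; length; lookup; applyUpTo)
open import Data.List.Relation.Binary.Permutation.Propositional using (_↭_)
open import Data.Fin using (Fin; toℕ)
import Data.Fin as Fin
import Data.Empty
open import Data.Product using (_×_; ∃; ∃-syntax; Σ-syntax)
open import Data.Sum using (_⊎_)
open import Relation.Binary.PropositionalEquality using (_≡_; _≢_)
open import Relation.Binary.Construct.Closure.ReflexiveTransitive using (Star)
open import Function.Bundles using (_⇔_)

data CombGen (s t : ℕ) : ℕ → ℕ → Set where
  spine : ∀ {i} → 1 ≤ i → i ≤ s ∸ 1 → CombGen s t i (suc i)
  tooth : ∀ {x} → 1 ≤ x → x ≤ (t ∸ 1) * s → CombGen s t x (x + s)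

_≤[α_,_]_ : ℕ → ℕ → ℕ → ℕ → Set
a ≤[α s , t ] b = Star (CombGen s t) a b

ground : ℕ → List ℕ
ground n = applyUpTo suc n

AppearsBefore : List ℕ → ℕ → ℕ → Set
AppearsBefore v a b = ∃[ i ] ∃[ j ] (toℕ i < toℕ j × lookup v i ≡ a × lookup v j ≡ b)

IsLinExt : ℕ → ℕ → List ℕ → Set
IsLinExt s t v =
  (v ↭ ground (s * t)) ×
  (∀ a b → a ≤[α s , t ] b → a ≢ b → AppearsBefore v a b)

-- A pattern in S_3 is given as a function Fin 3 → ℕ (its one-line notation).
-- v contains w if there are indices i<j<k with (v_i,v_j,v_k) in the same
-- relative order as (w_1,w_2,w_3).
Contains : (Fin 3 → ℕ) → List ℕ → Set
Contains w v =
  Σ[ f ∈ (Fin 3 → Fin (length v)) ]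
    ( (∀ p q → toℕ p < toℕ q → toℕ (f p) < toℕ (f q))
    × (∀ p q → (lookup v (f p) < lookup v (f q)) ⇔ (w p < w q)) )

Avoids : (Fin 3 → ℕ) → List ℕ → Set
Avoids w v = Contains w v → Data.Empty.⊥

p213 : Fin 3 → ℕ
p213 Fin.zero = 2
p213 (Fin.suc Fin.zero) = 1
p213 (Fin.suc (Fin.suc Fin.zero)) = 3

p312 : Fin 3 → ℕ
p312 Fin.zero = 3
p312 (Fin.suc Fin.zero) = 1
p312 (Fin.suc (Fin.suc Fin.zero)) = 2

-- A duplicate-free list avoids both 213 and 312 exactly when it has no
-- valley, i.e. no entry with a larger entry somewhere on each side.  Let
-- m = (t-1)s.  In a valley-free linear extension of α_{s,t} the entries
-- 1,…,m come first and in increasing order: if the first entry h is not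
-- the least remaining element x ≤ m, then h, x, x+s is a valley, since x
-- precedes its tooth successor x+s.  The remaining entries, the tips
-- m+1,…,m+s of the teeth, are unconstrained by the order and only have to
-- form a valley-free arrangement; in such an arrangement the least entry
-- sits at one of the two ends, so there are 2^(s-1) of them.
module Submission where

open import Defs
open import Data.Nat using (ℕ; _≤_; _*_; _^_; _∸_)
open import Data.List using (List; length)
open import Data.List.Relation.Unary.Unique.Propositional using (Unique)
open import Data.List.Membership.Propositional using (_∈_)
open import Data.Product using (_×_; Σ-syntax)
open import Relation.Binary.PropositionalEquality using (_≡_)
open import Function.Bundles using (_⇔_)

open import Data.Nat using (zero; suc; _+_; _<_; z≤n; s≤s; _≟_; _<?_)
open import Data.Nat.Properties
open import Data.Fin using (Fin; toℕ) renaming (zero to fzero; suc to fsuc)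
open import Data.List using ([]; _∷_; _++_; _∷ʳ_; [_]; map; lookup; applyUpTo)
open import Data.List.Properties using (++-identityʳ; ∷-injectiveˡ; ∷-injectiveʳ; ∷ʳ-injective; length-++; length-map; ++-cancelˡ)
open import Data.List.Relation.Unary.Any using (Any; here; there; index)
import Data.List.Relation.Unary.Any as Any
open import Data.List.Relation.Unary.Any.Properties using (lookup-index)
import Data.List.Relation.Unary.Any.Properties as Anyₚ
open import Data.List.Relation.Unary.All using (All; []; _∷_)
import Data.List.Relation.Unary.All as All
open import Data.List.Relation.Unary.All.Properties using (All¬⇒¬Any)
import Data.List.Relation.Unary.All.Properties as Allₚ
open import Data.List.Relation.Unary.AllPairs using ([]; _∷_)
import Data.List.Relation.Unary.Unique.Propositional.Properties as Unique
open import Data.List.Membership.Propositional using (lose)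
open import Data.List.Membership.Propositional.Properties using (∈-map⁺; ∈-map⁻; ∈-++⁺ˡ; ∈-++⁺ʳ; ∈-++⁻; ∈-∃++; ∈-lookup)
open import Data.List.Relation.Binary.Permutation.Propositional using (_↭_; ↭-sym; ↭-trans; ↭-refl; prep; ↭⇒↭ₛ)
open import Data.List.Relation.Binary.Permutation.Propositional.Properties using (∈-resp-↭; All-resp-↭; ↭-empty-inv; ↭-singleton-inv; drop-∷; ∷↭∷ʳ; ++⁺ˡ; shift)
open import Data.List.Relation.Binary.Permutation.Setoid.Properties using (Unique-resp-↭)
open import Data.Product using (_,_; proj₁; ∃-syntax)
open import Data.Sum using (_⊎_; inj₁; inj₂; [_,_]′)
open import Data.Empty using (⊥-elim)
open import Function using (_∘_)
open import Function.Bundles using (mk⇔; module Equivalence)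
open import Relation.Nullary using (¬_; yes; no)
open import Relation.Nullary.Decidable using (from-yes; from-no)
open import Relation.Binary.Definitions using (tri<; tri≈; tri>)
open import Relation.Binary.PropositionalEquality using (_≢_; refl; sym; trans; cong; cong₂; subst; ≢-sym; setoid; module ≡-Reasoning)
open import Relation.Binary.Construct.Closure.ReflexiveTransitive using (ε; _◅_)

range : ℕ → ℕ → List ℕ
range lo zero    = []
range lo (suc n) = lo ∷ range (suc lo) n

∈-range⁺ : ∀ lo n {b} → lo ≤ b → b < lo + n → b ∈ range lo n
∈-range⁺ lo zero    lo≤b b<lo+0 = ⊥-elim (≤⇒≯ lo≤b (subst (_ <_) (+-identityʳ lo) b<lo+0))
∈-range⁺ lo (suc n) {b} lo≤b b<lo+n with b ≟ lo
... | yes b≡lo = here b≡lo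
... | no  b≢lo = there (∈-range⁺ (suc lo) n (≤∧≢⇒< lo≤b (≢-sym b≢lo)) (subst (b <_) (+-suc lo n) b<lo+n))

range-≥ : ∀ lo n → All (lo ≤_) (range lo n)
range-≥ lo zero    = []
range-≥ lo (suc n) = ≤-refl ∷ All.map (≤-trans (n≤1+n lo)) (range-≥ (suc lo) n)

↭-range-≥ : ∀ {lo n w} → w ↭ range lo n → All (lo ≤_) w
↭-range-≥ {lo} {n} w↭ = All-resp-↭ (↭-sym w↭) (range-≥ lo n)

range-++ : ∀ lo m n → range lo (m + n) ≡ range lo m ++ range (lo + m) n
range-++ lo zero    n = cong (λ lo′ → range lo′ n) (sym (+-identityʳ lo))
range-++ lo (suc m) n = cong (lo ∷_) (trans (range-++ (suc lo) m n)
                                           (cong (λ lo′ → range (suc lo) m ++ range lo′ n) (sym (+-suc lo m))))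

range-unique : ∀ lo n → Unique (range lo n)
range-unique lo zero    = []
range-unique lo (suc n) = All.map (λ lo<x lo≡x → <-irrefl lo≡x lo<x) (range-≥ (suc lo) n) ∷ range-unique (suc lo) n

ground≡range : ∀ n → ground n ≡ range 1 n
ground≡range n = applyUpTo-range suc 1 n (λ _ → refl)
  where
  applyUpTo-range : ∀ f lo n → (∀ i → f i ≡ lo + i) → applyUpTo f n ≡ range lo n
  applyUpTo-range f lo zero    f≗ = refl
  applyUpTo-range f lo (suc n) f≗ =
    cong₂ _∷_ (trans (f≗ 0) (+-identityʳ lo))
              (applyUpTo-range (f ∘ suc) (suc lo) n (λ i → trans (f≗ (suc i)) (+-suc lo i)))

-- A valley is an entry with a larger entry somewhere on each side;
-- DipBelow x w says that x followed by w has a valley whose left entry is x.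
data DipBelow (x : ℕ) : List ℕ → Set where
  here  : ∀ {b w} → b < x → Any (b <_) w → DipBelow x (b ∷ w)
  there : ∀ {y w} → DipBelow x w → DipBelow x (y ∷ w)

data Valley : List ℕ → Set where
  here  : ∀ {x w} → DipBelow x w → Valley (x ∷ w)
  there : ∀ {x w} → Valley w → Valley (x ∷ w)

dipBelow⇒Any< : ∀ {x w} → DipBelow x w → Any (_< x) w
dipBelow⇒Any< (here b<x _) = here b<x
dipBelow⇒Any< (there d)    = there (dipBelow⇒Any< d)

dipBelow-++⁺ʳ : ∀ ps {x w} → DipBelow x w → DipBelow x (ps ++ w)
dipBelow-++⁺ʳ []       d = d
dipBelow-++⁺ʳ (_ ∷ ps) d = there (dipBelow-++⁺ʳ ps d)

dipBelow-++⁺ˡ : ∀ {x w} ys → DipBelow x w → DipBelow x (w ++ ys)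
dipBelow-++⁺ˡ ys (here b<x b<w) = here b<x (Anyₚ.++⁺ˡ b<w)
dipBelow-++⁺ˡ ys (there d)      = there (dipBelow-++⁺ˡ ys d)

valley-++⁺ˡ : ∀ {w} ys → Valley w → Valley (w ++ ys)
valley-++⁺ˡ ys (here d)  = here (dipBelow-++⁺ˡ ys d)
valley-++⁺ˡ ys (there v) = there (valley-++⁺ˡ ys v)

dipBelow-∷ʳ⁻ : ∀ {y x} w → DipBelow y (w ∷ʳ x) → DipBelow y w ⊎ Any (_< x) w
dipBelow-∷ʳ⁻ [] (here _ ())
dipBelow-∷ʳ⁻ [] (there ())
dipBelow-∷ʳ⁻ (b ∷ w) (here b<y b<w∷ʳx) with Anyₚ.++⁻ w b<w∷ʳx
... | inj₁ b<w         = inj₁ (here b<y b<w)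
... | inj₂ (here b<x)  = inj₂ (here b<x)
dipBelow-∷ʳ⁻ (b ∷ w) (there d) with dipBelow-∷ʳ⁻ w d
... | inj₁ d′    = inj₁ (there d′)
... | inj₂ w<x   = inj₂ (there w<x)

¬valley-∷ : ∀ {x w} → All (x <_) w → ¬ Valley w → ¬ Valley (x ∷ w)
¬valley-∷ x<w ¬v (here d)  = All¬⇒¬Any (All.map <⇒≯ x<w) (dipBelow⇒Any< d)
¬valley-∷ x<w ¬v (there v) = ¬v v

¬valley-∷ʳ : ∀ {x} w → All (x <_) w → ¬ Valley w → ¬ Valley (w ∷ʳ x)
¬valley-∷ʳ []      _   _  (here ())
¬valley-∷ʳ []      _   _  (there ())
¬valley-∷ʳ (y ∷ w) x<w ¬v (here d) with dipBelow-∷ʳ⁻ w d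
... | inj₁ d′  = ¬v (here d′)
... | inj₂ w<x = All¬⇒¬Any (All.map <⇒≯ (All.tail x<w)) w<x
¬valley-∷ʳ (y ∷ w) x<w ¬v (there v) = ¬valley-∷ʳ w (All.tail x<w) (¬v ∘ there) v

¬valley-range-++ : ∀ lo n {u} → All (lo + n ≤_) u → ¬ Valley u → ¬ Valley (range lo n ++ u)
¬valley-range-++ lo zero    {u} u≥ ¬v = ¬v
¬valley-range-++ lo (suc n) {u} u≥ ¬v =
  ¬valley-∷ (Allₚ.++⁺ (range-≥ (suc lo) n) (All.map (<-≤-trans (m<m+n lo (s≤s z≤n))) u≥))
            (¬valley-range-++ (suc lo) n (All.map (λ {y} → subst (_≤ y) (+-suc lo n)) u≥) ¬v)

unimodal : ℕ → ℕ → List (List ℕ)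
unimodal lo zero          = [ [] ]
unimodal lo (suc zero)    = [ [ lo ] ]
unimodal lo (suc (suc k)) = map (lo ∷_) (unimodal (suc lo) (suc k)) ++ map (_∷ʳ lo) (unimodal (suc lo) (suc k))

unimodal-sound-step : ∀ lo k →
  (∀ {u′} → u′ ∈ unimodal (suc lo) (suc k) → u′ ↭ range (suc lo) (suc k) × ¬ Valley u′) →
  ∀ {u} → u ∈ unimodal lo (suc (suc k)) → u ↭ range lo (suc (suc k)) × ¬ Valley u
unimodal-sound-step lo k sound′ u∈ with ∈-++⁻ (map (lo ∷_) (unimodal (suc lo) (suc k))) u∈
... | inj₁ u∈ˡ with u′ , u′∈ , refl ← ∈-map⁻ (lo ∷_) u∈ˡ =
  let u′↭ , ¬v = sound′ u′∈
  in prep lo u′↭ , ¬valley-∷ (↭-range-≥ u′↭) ¬v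
... | inj₂ u∈ʳ with u′ , u′∈ , refl ← ∈-map⁻ (_∷ʳ lo) u∈ʳ =
  let u′↭ , ¬v = sound′ u′∈
  in ↭-trans (↭-sym (∷↭∷ʳ lo u′)) (prep lo u′↭) , ¬valley-∷ʳ u′ (↭-range-≥ u′↭) ¬v

unimodal-sound : ∀ lo k {u} → u ∈ unimodal lo k → u ↭ range lo k × ¬ Valley u
unimodal-sound lo zero          (here refl) = ↭-refl , λ ()
unimodal-sound lo (suc zero)    (here refl) = ↭-refl , λ { (here ()) ; (there ()) }
unimodal-sound lo (suc (suc k))             = unimodal-sound-step lo k (unimodal-sound (suc lo) (suc k))

-- A valley-free arrangement of [lo, lo+k+2) has its least entry lo at one
-- of its ends, next to a valley-free arrangement of [lo+1, lo+k+2).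
unimodal-complete-step : ∀ lo k →
  (∀ {w′} → w′ ↭ range (suc lo) (suc k) → ¬ Valley w′ → w′ ∈ unimodal (suc lo) (suc k)) →
  ∀ {w} → w ↭ range lo (suc (suc k)) → ¬ Valley w → w ∈ unimodal lo (suc (suc k))
unimodal-complete-step lo k complete′ w↭ ¬v with ps , qs , refl ← ∈-∃++ (∈-resp-↭ (↭-sym w↭) (here refl)) =
  at-an-end ps qs (drop-∷ (↭-trans (↭-sym (shift lo ps qs)) w↭)) ¬v
  where
  at-an-end : ∀ ps qs → ps ++ qs ↭ range (suc lo) (suc k) → ¬ Valley (ps ++ [ lo ] ++ qs) →
              ps ++ [ lo ] ++ qs ∈ unimodal lo (suc (suc k))
  at-an-end []       qs       r ¬v = ∈-++⁺ˡ (∈-map⁺ (lo ∷_) (complete′ r (¬v ∘ there)))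
  at-an-end (a ∷ ps) []       r ¬v =
    ∈-++⁺ʳ (map (lo ∷_) (unimodal (suc lo) (suc k)))
      (∈-map⁺ (_∷ʳ lo) (complete′ (subst (_↭ range (suc lo) (suc k)) (++-identityʳ (a ∷ ps)) r)
                                  (¬v ∘ valley-++⁺ˡ [ lo ])))
  at-an-end (a ∷ ps) (c ∷ qs) r ¬v = ⊥-elim (¬v (here (dipBelow-++⁺ʳ ps (here lo<a (here lo<c)))))
    where
    lo<a : lo < a
    lo<a = All.head (↭-range-≥ r)
    lo<c : lo < c
    lo<c = All.lookup (↭-range-≥ r) (∈-++⁺ʳ (a ∷ ps) (here refl))

unimodal-complete : ∀ lo k {w} → w ↭ range lo k → ¬ Valley w → w ∈ unimodal lo k
unimodal-complete lo zero          w↭ ¬v rewrite ↭-empty-inv w↭     = here refl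
unimodal-complete lo (suc zero)    w↭ ¬v rewrite ↭-singleton-inv w↭ = here refl
unimodal-complete lo (suc (suc k))       = unimodal-complete-step lo k (unimodal-complete (suc lo) (suc k))

length-unimodal : ∀ lo k → length (unimodal lo (suc k)) ≡ 2 ^ k
length-unimodal lo zero    = refl
length-unimodal lo (suc k) = begin
  length (map (lo ∷_) U ++ map (_∷ʳ lo) U)        ≡⟨ length-++ (map (lo ∷_) U) ⟩
  length (map (lo ∷_) U) + length (map (_∷ʳ lo) U) ≡⟨ cong₂ _+_ (length-map (lo ∷_) U) (length-map (_∷ʳ lo) U) ⟩
  length U + length U                             ≡⟨ cong₂ _+_ (length-unimodal (suc lo) k) (length-unimodal (suc lo) k) ⟩
  2 ^ k + 2 ^ k                                   ≡⟨ cong (2 ^ k +_) (sym (+-identityʳ (2 ^ k))) ⟩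
  2 ^ suc k                                       ∎
  where
  open ≡-Reasoning
  U = unimodal (suc lo) (suc k)

unimodal-unique : ∀ lo k → Unique (unimodal lo k)
unimodal-unique lo zero          = [] ∷ []
unimodal-unique lo (suc zero)    = [] ∷ []
unimodal-unique lo (suc (suc k)) =
  Unique.++⁺ (Unique.map⁺ ∷-injectiveʳ (unimodal-unique (suc lo) (suc k)))
             (Unique.map⁺ (λ {u} {u′} eq → proj₁ (∷ʳ-injective u u′ eq)) (unimodal-unique (suc lo) (suc k)))
             heads-differ
  where
  heads-differ : ∀ {v} → ¬ (v ∈ map (lo ∷_) (unimodal (suc lo) (suc k)) × v ∈ map (_∷ʳ lo) (unimodal (suc lo) (suc k)))
  heads-differ (v∈ˡ , v∈ʳ) with _ , _ , refl ← ∈-map⁻ (lo ∷_) v∈ˡ | ∈-map⁻ (_∷ʳ lo) v∈ʳ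
  ... | []    , u∈ , _  with () ← ↭-empty-inv (↭-sym (proj₁ (unimodal-sound (suc lo) (suc k) u∈)))
  ... | c ∷ _ , u∈ , eq = <-irrefl (∷-injectiveˡ eq) (All.head (↭-range-≥ (proj₁ (unimodal-sound (suc lo) (suc k) u∈))))

data Precedes (a b : ℕ) : List ℕ → Set where
  here  : ∀ {w} → b ∈ w → Precedes a b (a ∷ w)
  there : ∀ {x w} → Precedes a b w → Precedes a b (x ∷ w)

appearsBefore⇒precedes : ∀ v {a b} → AppearsBefore v a b → Precedes a b v
appearsBefore⇒precedes (x ∷ w) (fzero  , fsuc j , _       , refl , refl) = here (∈-lookup j)
appearsBefore⇒precedes (x ∷ w) (fsuc i , fsuc j , s≤s i<j , a≡  , b≡) =
  there (appearsBefore⇒precedes w (i , j , i<j , a≡ , b≡))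

precedes⇒appearsBefore : ∀ {v a b} → Precedes a b v → AppearsBefore v a b
precedes⇒appearsBefore (here b∈w) = fzero , fsuc (index b∈w) , s≤s z≤n , refl , sym (lookup-index b∈w)
precedes⇒appearsBefore (there p) with i , j , i<j , a≡ , b≡ ← precedes⇒appearsBefore p =
  fsuc i , fsuc j , s≤s i<j , a≡ , b≡

precedes-tail : ∀ {a b x w} → Precedes a b (x ∷ w) → a ≢ x → Precedes a b w
precedes-tail (here _)  a≢a = ⊥-elim (a≢a refl)
precedes-tail (there p) _   = p

precedes⇒dipBelow : ∀ {a b x w} → Precedes a b w → a < x → a < b → DipBelow x w
precedes⇒dipBelow (here b∈w) a<x a<b = here a<x (lose b∈w a<b)
precedes⇒dipBelow (there p)  a<x a<b = there (precedes⇒dipBelow p a<x a<b)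

precedes-range-++ : ∀ lo n {u a b} → lo ≤ a → a < lo + n → a < b → b ∈ range lo n ++ u →
                    Precedes a b (range lo n ++ u)
precedes-range-++ lo zero    lo≤a a<lo+0 _ _ = ⊥-elim (≤⇒≯ lo≤a (subst (_ <_) (+-identityʳ lo) a<lo+0))
precedes-range-++ lo (suc n) {a = a} lo≤a a<lo+n a<b b∈ with a ≟ lo
... | yes refl = here (Any.tail (λ b≡a → <-irrefl (sym b≡a) a<b) b∈)
... | no  a≢lo = there (precedes-range-++ (suc lo) n (≤∧≢⇒< lo≤a (≢-sym a≢lo)) (subst (a <_) (+-suc lo n) a<lo+n) a<b
                          (Any.tail (λ b≡lo → <-irrefl (sym b≡lo) (≤-<-trans lo≤a a<b)) b∈))

-- The first entry must be lo: a larger one h would form the valley h, lo, lo+d.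
forced-prefix : ∀ d → 1 ≤ d → ∀ k lo {w} → w ↭ range lo (k + d) → ¬ Valley w →
                (∀ x → lo ≤ x → x < lo + k → Precedes x (x + d) w) →
                ∃[ u ] u ↭ range (lo + k) d × ¬ Valley u × w ≡ range lo k ++ u
forced-prefix d 1≤d zero lo {w} w↭ ¬v _ = w , subst (λ lo′ → w ↭ range lo′ d) (sym (+-identityʳ lo)) w↭ , ¬v , refl
forced-prefix d 1≤d (suc k) lo {[]} w↭ ¬v _ with () ← ↭-empty-inv (↭-sym w↭)
forced-prefix d 1≤d (suc k) lo {h ∷ w} w↭ ¬v precedes with h ≟ lo
... | yes refl =
  let u , u↭ , ¬vu , w≡ = forced-prefix d 1≤d k (suc lo) (drop-∷ w↭) (¬v ∘ there) precedes′
  in u , subst (λ lo′ → u ↭ range lo′ d) (sym (+-suc lo k)) u↭ , ¬vu , cong (lo ∷_) w≡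
  where
  precedes′ : ∀ x → suc lo ≤ x → x < suc lo + k → Precedes x (x + d) w
  precedes′ x lo<x x<lo+k =
    precedes-tail (precedes x (<⇒≤ lo<x) (subst (x <_) (sym (+-suc lo k)) x<lo+k)) (λ x≡lo → <-irrefl (sym x≡lo) lo<x)
... | no h≢lo = ⊥-elim (¬v (here (precedes⇒dipBelow lo-before-lo+d lo<h (m<m+n lo 1≤d))))
  where
  lo<h : lo < h
  lo<h = ≤∧≢⇒< (All.head (↭-range-≥ w↭)) (≢-sym h≢lo)
  lo-before-lo+d : Precedes lo (lo + d) w
  lo-before-lo+d = precedes-tail (precedes lo ≤-refl (m<m+n lo (s≤s z≤n))) (≢-sym h≢lo)

record IndexValley (v : List ℕ) : Set where
  field
    i j k   : Fin (length v)
    i<j     : toℕ i < toℕ j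
    j<k     : toℕ j < toℕ k
    vj<vi   : lookup v j < lookup v i
    vj<vk   : lookup v j < lookup v k

indices⇒dipBelow : ∀ {x} w (j k : Fin (length w)) → toℕ j < toℕ k → lookup w j < x → lookup w j < lookup w k →
                   DipBelow x w
indices⇒dipBelow (b ∷ w) fzero    (fsuc k) _         b<x b<wk = here b<x (lose {P = b <_} (∈-lookup k) b<wk)
indices⇒dipBelow (b ∷ w) (fsuc j) (fsuc k) (s≤s j<k) wj<x wj<wk = there (indices⇒dipBelow w j k j<k wj<x wj<wk)

indexValley⇒valley : ∀ v → IndexValley v → Valley v
indexValley⇒valley (x ∷ w) record { i = fzero ; j = fsuc j ; k = fsuc k ; j<k = s≤s j<k ; vj<vi = vj<vi ; vj<vk = vj<vk } =
  here (indices⇒dipBelow w j k j<k vj<vi vj<vk)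
indexValley⇒valley (x ∷ w) record { i = fsuc i ; j = fsuc j ; k = fsuc k ; i<j = s≤s i<j ; j<k = s≤s j<k ; vj<vi = vj<vi ; vj<vk = vj<vk } =
  there (indexValley⇒valley w record { i = i ; j = j ; k = k ; i<j = i<j ; j<k = j<k ; vj<vi = vj<vi ; vj<vk = vj<vk })

dipBelow⇒indices : ∀ {x w} → DipBelow x w →
  Σ[ j ∈ Fin (length w) ] Σ[ k ∈ Fin (length w) ] toℕ j < toℕ k × lookup w j < x × lookup w j < lookup w k
dipBelow⇒indices (here b<x b<w) = fzero , fsuc (index b<w) , s≤s z≤n , b<x , lookup-index b<w
dipBelow⇒indices (there d) with j , k , j<k , wj<x , wj<wk ← dipBelow⇒indices d =
  fsuc j , fsuc k , s≤s j<k , wj<x , wj<wk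

valley⇒indexValley : ∀ {v} → Valley v → IndexValley v
valley⇒indexValley (here d) with j , k , j<k , wj<x , wj<wk ← dipBelow⇒indices d =
  record { i = fzero ; j = fsuc j ; k = fsuc k ; i<j = s≤s z≤n ; j<k = s≤s j<k ; vj<vi = wj<x ; vj<vk = wj<wk }
valley⇒indexValley (there v) =
  let open IndexValley (valley⇒indexValley v)
  in record { i = fsuc i ; j = fsuc j ; k = fsuc k ; i<j = s≤s i<j ; j<k = s≤s j<k ; vj<vi = vj<vi ; vj<vk = vj<vk }

contains⇒indexValley : ∀ w {v} → Contains w v → w (fsuc fzero) < w fzero → w (fsuc fzero) < w (fsuc (fsuc fzero)) →
                       IndexValley v
contains⇒indexValley w (f , f-mono , f-order) w₁<w₀ w₁<w₂ = record
  { i = f fzero ; j = f (fsuc fzero) ; k = f (fsuc (fsuc fzero))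
  ; i<j = f-mono fzero (fsuc fzero) (s≤s z≤n)
  ; j<k = f-mono (fsuc fzero) (fsuc (fsuc fzero)) (s≤s (s≤s z≤n))
  ; vj<vi = Equivalence.from (f-order (fsuc fzero) fzero) w₁<w₀
  ; vj<vk = Equivalence.from (f-order (fsuc fzero) (fsuc (fsuc fzero))) w₁<w₂
  }

Unique⇒lookup-≢ : ∀ (v : List ℕ) → Unique v → (i k : Fin (length v)) → toℕ i < toℕ k → lookup v i ≢ lookup v k
Unique⇒lookup-≢ (x ∷ w) (x∉w ∷ _) fzero    (fsuc k) _         = All.lookup x∉w (∈-lookup k)
Unique⇒lookup-≢ (x ∷ w) (_ ∷ uw)  (fsuc i) (fsuc k) (s≤s i<k) = Unique⇒lookup-≢ w uw i k i<k

triple : ∀ {n} → Fin n → Fin n → Fin n → Fin 3 → Fin n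
triple i j k fzero               = i
triple i j k (fsuc fzero)        = j
triple i j k (fsuc (fsuc fzero)) = k

triple-mono : ∀ {n} {i j k : Fin n} → toℕ i < toℕ j → toℕ j < toℕ k →
              ∀ p q → toℕ p < toℕ q → toℕ (triple i j k p) < toℕ (triple i j k q)
triple-mono i<j j<k fzero        (fsuc fzero)        _ = i<j
triple-mono i<j j<k fzero        (fsuc (fsuc fzero)) _ = <-trans i<j j<k
triple-mono i<j j<k (fsuc fzero) (fsuc (fsuc fzero)) _ = j<k
triple-mono i<j j<k (fsuc fzero)        (fsuc fzero)        (s≤s ())
triple-mono i<j j<k (fsuc (fsuc fzero)) (fsuc fzero)        (s≤s ())
triple-mono i<j j<k (fsuc (fsuc fzero)) (fsuc (fsuc fzero)) (s≤s (s≤s ()))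

both : ∀ {A B : Set} → A → B → A ⇔ B
both a b = mk⇔ (λ _ → b) (λ _ → a)

neither : ∀ {A B : Set} → ¬ A → ¬ B → A ⇔ B
neither ¬a ¬b = mk⇔ (⊥-elim ∘ ¬a) (⊥-elim ∘ ¬b)

-- A valley v_i > v_j < v_k is an occurrence of 213 or of 312, according
-- as v_i < v_k or v_i > v_k.
indexValley⇒contains : ∀ v → Unique v → IndexValley v → Contains p213 v ⊎ Contains p312 v
indexValley⇒contains v uv record { i = i ; j = j ; k = k ; i<j = i<j ; j<k = j<k ; vj<vi = vj<vi ; vj<vk = vj<vk }
  with <-cmp (lookup v i) (lookup v k)
... | tri≈ _ vi≡vk _ = ⊥-elim (Unique⇒lookup-≢ v uv i k (<-trans i<j j<k) vi≡vk)
... | tri< vi<vk _ _ = inj₁ (triple i j k , triple-mono i<j j<k , order)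
  where
  order : ∀ p q → (lookup v (triple i j k p) < lookup v (triple i j k q)) ⇔ (p213 p < p213 q)
  order fzero               fzero               = neither (<-irrefl refl) (<-irrefl refl)
  order fzero               (fsuc fzero)        = neither (<-asym vj<vi) (from-no (2 <? 1))
  order fzero               (fsuc (fsuc fzero)) = both vi<vk (from-yes (2 <? 3))
  order (fsuc fzero)        fzero               = both vj<vi (from-yes (1 <? 2))
  order (fsuc fzero)        (fsuc fzero)        = neither (<-irrefl refl) (<-irrefl refl)
  order (fsuc fzero)        (fsuc (fsuc fzero)) = both vj<vk (from-yes (1 <? 3))
  order (fsuc (fsuc fzero)) fzero               = neither (<-asym vi<vk) (from-no (3 <? 2))
  order (fsuc (fsuc fzero)) (fsuc fzero)        = neither (<-asym vj<vk) (from-no (3 <? 1))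
  order (fsuc (fsuc fzero)) (fsuc (fsuc fzero)) = neither (<-irrefl refl) (<-irrefl refl)
... | tri> _ _ vk<vi = inj₂ (triple i j k , triple-mono i<j j<k , order)
  where
  order : ∀ p q → (lookup v (triple i j k p) < lookup v (triple i j k q)) ⇔ (p312 p < p312 q)
  order fzero               fzero               = neither (<-irrefl refl) (<-irrefl refl)
  order fzero               (fsuc fzero)        = neither (<-asym vj<vi) (from-no (3 <? 1))
  order fzero               (fsuc (fsuc fzero)) = neither (<-asym vk<vi) (from-no (3 <? 2))
  order (fsuc fzero)        fzero               = both vj<vi (from-yes (1 <? 3))
  order (fsuc fzero)        (fsuc fzero)        = neither (<-irrefl refl) (<-irrefl refl)
  order (fsuc fzero)        (fsuc (fsuc fzero)) = both vj<vk (from-yes (1 <? 2))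
  order (fsuc (fsuc fzero)) fzero               = both vk<vi (from-yes (2 <? 3))
  order (fsuc (fsuc fzero)) (fsuc fzero)        = neither (<-asym vj<vk) (from-no (2 <? 1))
  order (fsuc (fsuc fzero)) (fsuc (fsuc fzero)) = neither (<-irrefl refl) (<-irrefl refl)

avoids-213-312⇔¬valley : ∀ v → Unique v → (Avoids p213 v × Avoids p312 v) ⇔ (¬ Valley v)
avoids-213-312⇔¬valley v uv = mk⇔
  (λ (¬213 , ¬312) → [ ¬213 , ¬312 ]′ ∘ indexValley⇒contains v uv ∘ valley⇒indexValley)
  (λ ¬v → (¬v ∘ indexValley⇒valley v ∘ λ c → contains⇒indexValley p213 c (from-yes (1 <? 2)) (from-yes (1 <? 3)))
        , (¬v ∘ indexValley⇒valley v ∘ λ c → contains⇒indexValley p312 c (from-yes (1 <? 3)) (from-yes (1 <? 2))))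

n≤[m∸1]*n : ∀ {m} n → 2 ≤ m → n ≤ (m ∸ 1) * n
n≤[m∸1]*n {suc zero}    n (s≤s ())
n≤[m∸1]*n {suc (suc m)} n _ = m≤m+n n (m * n)

n*m≡[m∸1]*n+n : ∀ {m} n → 1 ≤ m → n * m ≡ (m ∸ 1) * n + n
n*m≡[m∸1]*n+n {suc m} n _ = trans (*-comm n (suc m)) (+-comm n (m * n))

module Comb {s t : ℕ} (1≤s : 1 ≤ s) (2≤t : 2 ≤ t) where

  -- The elements 1,…,m have a tooth successor; m+1,…,m+s are the tips.
  m : ℕ
  m = (t ∸ 1) * s

  ground≡ : ground (s * t) ≡ range 1 (m + s)
  ground≡ = trans (cong ground (n*m≡[m∸1]*n+n s (≤-trans (n≤1+n 1) 2≤t))) (ground≡range (m + s))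

  CombBounds : ℕ → ℕ → Set
  CombBounds a b = 1 ≤ a × a ≤ m × a < b × b ≤ m + s

  generator-bounds : ∀ {a b} → CombGen s t a b → CombBounds a b
  generator-bounds {i} (spine 1≤i i≤s∸1) =
    1≤i , ≤-trans (≤-trans i≤s∸1 (m∸n≤m s 1)) (n≤[m∸1]*n s 2≤t) , n<1+n i ,
    ≤-trans (≤-trans (s≤s i≤s∸1) (≤-reflexive (m+[n∸m]≡n 1≤s))) (m≤n+m s m)
  generator-bounds {x} (tooth 1≤x x≤m) = 1≤x , x≤m , m<m+n x 1≤s , +-monoˡ-≤ s x≤m

  order-bounds : ∀ {a b} → a ≤[α s , t ] b → a ≡ b ⊎ CombBounds a b
  order-bounds ε = inj₁ refl
  order-bounds (g ◅ r) with generator-bounds g | order-bounds r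
  ... | bounds | inj₁ refl = inj₂ bounds
  ... | 1≤a , a≤m , a<c , _ | inj₂ (_ , _ , c<b , b≤m+s) = inj₂ (1≤a , a≤m , <-trans a<c c<b , b≤m+s)

  isLinExt-unique : ∀ {v} → IsLinExt s t v → Unique v
  isLinExt-unique (v↭ , _) =
    Unique-resp-↭ (setoid ℕ) (↭⇒↭ₛ (↭-sym (subst (_ ↭_) ground≡ v↭))) (range-unique 1 (m + s))

  isLinExt-prefixed : ∀ {u} → u ↭ range (suc m) s → IsLinExt s t (range 1 m ++ u)
  isLinExt-prefixed {u} u↭ = subst (range 1 m ++ u ↭_) (sym ground≡) v↭ , ordered
    where
    v↭ : range 1 m ++ u ↭ range 1 (m + s)
    v↭ = subst (range 1 m ++ u ↭_) (sym (range-++ 1 m s)) (++⁺ˡ (range 1 m) u↭)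
    ordered : ∀ a b → a ≤[α s , t ] b → a ≢ b → AppearsBefore (range 1 m ++ u) a b
    ordered a b a≤b a≢b with order-bounds a≤b
    ... | inj₁ a≡b = ⊥-elim (a≢b a≡b)
    ... | inj₂ (1≤a , a≤m , a<b , b≤m+s) =
      precedes⇒appearsBefore (precedes-range-++ 1 m 1≤a (s≤s a≤m) a<b
        (∈-resp-↭ (↭-sym v↭) (∈-range⁺ 1 (m + s) (≤-trans 1≤a (<⇒≤ a<b)) (s≤s b≤m+s))))

  isLinExt⇒prefixed : ∀ {v} → IsLinExt s t v → ¬ Valley v →
                      ∃[ u ] u ↭ range (suc m) s × ¬ Valley u × v ≡ range 1 m ++ u
  isLinExt⇒prefixed {v} (v↭ , ordered) ¬v = forced-prefix s 1≤s m 1 (subst (_ ↭_) ground≡ v↭) ¬v teeth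
    where
    teeth : ∀ x → 1 ≤ x → x < 1 + m → Precedes x (x + s) v
    teeth x 1≤x (s≤s x≤m) =
      appearsBefore⇒precedes v (ordered x (x + s) (tooth 1≤x x≤m ◅ ε) (λ x≡x+s → <-irrefl x≡x+s (m<m+n x 1≤s)))

  extensions : List (List ℕ)
  extensions = map (range 1 m ++_) (unimodal (suc m) s)

  ∈-extensions⇔ : ∀ v → (v ∈ extensions) ⇔ (IsLinExt s t v × Avoids p213 v × Avoids p312 v)
  ∈-extensions⇔ v = mk⇔ sound complete
    where
    sound : v ∈ extensions → IsLinExt s t v × Avoids p213 v × Avoids p312 v
    sound v∈ with u , u∈ , refl ← ∈-map⁻ (range 1 m ++_) v∈ =
      let u↭ , ¬vu = unimodal-sound (suc m) s u∈
          linExt = isLinExt-prefixed u↭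
      in linExt , Equivalence.from (avoids-213-312⇔¬valley v (isLinExt-unique linExt))
                    (¬valley-range-++ 1 m (↭-range-≥ u↭) ¬vu)
    complete : IsLinExt s t v × Avoids p213 v × Avoids p312 v → v ∈ extensions
    complete (linExt , avoids)
      with u , u↭ , ¬vu , refl ← isLinExt⇒prefixed linExt
             (Equivalence.to (avoids-213-312⇔¬valley v (isLinExt-unique linExt)) avoids) =
      ∈-map⁺ (range 1 m ++_) (unimodal-complete (suc m) s u↭ ¬vu)

theorem12 : (s t : ℕ) → 1 ≤ s → 2 ≤ t →
    Σ[ L ∈ List (List ℕ) ]
      ( Unique L
      × length L ≡ 2 ^ (s ∸ 1)
      × (∀ v → (v ∈ L) ⇔ (IsLinExt s t v × Avoids p213 v × Avoids p312 v)) )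
theorem12 s@(suc s′) t 1≤s 2≤t =
  extensions ,
  Unique.map⁺ (++-cancelˡ (range 1 m) _ _) (unimodal-unique (suc m) s) ,
  trans (length-map (range 1 m ++_) (unimodal (suc m) s)) (length-unimodal (suc m) s′) ,
  ∈-extensions⇔
  where open Comb 1≤s 2≤t
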